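{- For every graph, each of the properties "defensive alliance", "offensive alliance", "powerful alliance", "global defensive alliance", "global offensive alliance" and "global powerful alliance" is reconfiguration monotone increasing.
   Context: Graphs are finite, simple, undirected. For $A\subseteq V$: $N[A]=A\cup\bigcup_{v\in A}N(v)$, $\partial A=N[A]\setminus A$, $d_A(v)=|N(v)\cap A|$. $A$ is a defensive alliance if $d_A(v)+1\ge d_{V\setminus A}(v)$ for all $v\in A$; an offensive alliance if $d_A(v)\ge d_{V\setminus A}(v)+1$ for all $v\in\partial A$; a powerful alliance if both; global means additionally dominating ($N[A]=V$). $B$ is obtained from $A$ by a token jumping step if $|A|=|B|$ and $|A\setminus B|=1$. A property $X$ of vertex sets is reconfiguration monotone increasing if for all $A,B$ with property $X$ such that $B$ is obtained from $A$ by a token jumping step, and $v\in B\setminus A$, the set $A\cup\{v\}$ also has property $X$. -}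

module Defs where

open import Data.Nat using (ℕ; suc; _+_; _≥_)
open import Data.Bool using (Bool; true; false)
open import Data.Fin using (Fin)
open import Data.Fin.Subset using (Subset; _∈_; _∉_; ∁; _∩_; _∪_; _─_; ⁅_⁆; ∣_∣)
open import Data.Vec using (tabulate)
open import Data.Product using (Σ; ∃; _×_)
open import Data.Sum using (_⊎_)
open import Relation.Binary.PropositionalEquality using (_≡_)

record Graph (n : ℕ) : Set where
  field
    adj    : Fin n → Fin n → Bool
    sym    : ∀ u v → adj u v ≡ adj v u
    irrefl : ∀ v → adj v v ≡ false
open Graph public

module _ {n : ℕ} (G : Graph n) where

  N : Fin n → Subset n
  N v = tabulate (adj G v)

  deg : Subset n → Fin n → ℕ
  deg A v = ∣ N v ∩ A ∣

  _∈N[_] : Fin n → Subset n → Set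
  w ∈N[ A ] = w ∈ A ⊎ (∃ λ u → u ∈ A × w ∈ N u)

  _∈∂_ : Fin n → Subset n → Set
  w ∈∂ A = w ∈N[ A ] × w ∉ A

  Dominating : Subset n → Set
  Dominating A = ∀ w → w ∈N[ A ]

  DefensiveAlliance : Subset n → Set
  DefensiveAlliance A = ∀ v → v ∈ A → deg A v + 1 ≥ deg (∁ A) v

  OffensiveAlliance : Subset n → Set
  OffensiveAlliance A = ∀ v → v ∈∂ A → deg A v ≥ deg (∁ A) v + 1

  PowerfulAlliance : Subset n → Set
  PowerfulAlliance A = DefensiveAlliance A × OffensiveAlliance A

  GlobalDefensiveAlliance : Subset n → Set
  GlobalDefensiveAlliance A = DefensiveAlliance A × Dominating A

  GlobalOffensiveAlliance : Subset n → Set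
  GlobalOffensiveAlliance A = OffensiveAlliance A × Dominating A

  GlobalPowerfulAlliance : Subset n → Set
  GlobalPowerfulAlliance A = PowerfulAlliance A × Dominating A

TokenJump : {n : ℕ} → Subset n → Subset n → Set
TokenJump A B = ∣ A ∣ ≡ ∣ B ∣ × ∣ A ─ B ∣ ≡ 1

ReconfigurationMonotoneIncreasing : {n : ℕ} → (Subset n → Set) → Set
ReconfigurationMonotoneIncreasing {n} X =
  ∀ (A B : Subset n) → X A → X B → TokenJump A B →
  ∀ (v : Fin n) → v ∈ B → v ∉ A → X (A ∪ ⁅ v ⁆)

-- Every vertex of A ∪ {v} lies in A or is v ∈ B, and the token jump forces B ⊆ A ∪ {v}
-- (both B \ A and A \ B have exactly one element), so A ∪ {v} = A ∪ B.  It therefore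
-- suffices that each kind of alliance is closed under binary union.  Enlarging a set can
-- only raise d_A(w) and lower d_{V∖A}(w), so the alliance inequality at a vertex of A ∪ B
-- (or of ∂(A ∪ B)) is inherited from whichever of A, B accounts for that vertex.
module Submission where

open import Defs hiding (sym)
open import Data.Nat using (ℕ; suc; _+_; _≤_; _<_; _≥_)
open import Data.Nat.Properties
  using (+-suc; +-cancelˡ-≡; ≤-trans; +-monoˡ-≤; <-≤-trans; ≤-reflexive; n<1⇒n≡0; n≮0)
open import Data.Fin using (Fin; _≟_)
open import Data.Fin.Subset
open import Data.Fin.Subset.Properties
open import Data.Vec using (_∷_; [])
open import Data.Product using (_×_; _,_)
open import Data.Sum using (_⊎_; inj₁; inj₂)
open import Function using (_∘_)
open import Relation.Nullary using (yes; no; contradiction)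
open import Relation.Binary.PropositionalEquality
  using (_≡_; refl; sym; trans; cong; subst; module ≡-Reasoning)

private
  variable
    n : ℕ
    p q : Subset n
    x y : Fin n

∣p∣≡∣p∩q∣+∣p─q∣ : ∀ (p q : Subset n) → ∣ p ∣ ≡ ∣ p ∩ q ∣ + ∣ p ─ q ∣
∣p∣≡∣p∩q∣+∣p─q∣ []            []            = refl
∣p∣≡∣p∩q∣+∣p─q∣ (inside  ∷ p) (inside  ∷ q) = cong suc (∣p∣≡∣p∩q∣+∣p─q∣ p q)
∣p∣≡∣p∩q∣+∣p─q∣ (inside  ∷ p) (outside ∷ q) = trans (cong suc (∣p∣≡∣p∩q∣+∣p─q∣ p q)) (sym (+-suc _ _))
∣p∣≡∣p∩q∣+∣p─q∣ (outside ∷ p) (inside  ∷ q) = ∣p∣≡∣p∩q∣+∣p─q∣ p q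
∣p∣≡∣p∩q∣+∣p─q∣ (outside ∷ p) (outside ∷ q) = ∣p∣≡∣p∩q∣+∣p─q∣ p q

∣p∣≡∣q∣⇒∣q─p∣≡∣p─q∣ : ∀ (p q : Subset n) → ∣ p ∣ ≡ ∣ q ∣ → ∣ q ─ p ∣ ≡ ∣ p ─ q ∣
∣p∣≡∣q∣⇒∣q─p∣≡∣p─q∣ p q ∣p∣≡∣q∣ = +-cancelˡ-≡ ∣ p ∩ q ∣ _ _ (begin
  ∣ p ∩ q ∣ + ∣ q ─ p ∣  ≡⟨ cong (λ r → ∣ r ∣ + ∣ q ─ p ∣) (∩-comm p q) ⟩
  ∣ q ∩ p ∣ + ∣ q ─ p ∣  ≡⟨ ∣p∣≡∣p∩q∣+∣p─q∣ q p ⟨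
  ∣ q ∣                  ≡⟨ ∣p∣≡∣q∣ ⟨
  ∣ p ∣                  ≡⟨ ∣p∣≡∣p∩q∣+∣p─q∣ p q ⟩
  ∣ p ∩ q ∣ + ∣ p ─ q ∣  ∎)
  where open ≡-Reasoning

-- If x ≢ y then |p - x - y| < |p - x| < |p| = 1, which is impossible.
∣p∣≡1∧x∈p∧y∈p⇒x≡y : ∣ p ∣ ≡ 1 → x ∈ p → y ∈ p → x ≡ y
∣p∣≡1∧x∈p∧y∈p⇒x≡y {p = p} {x = x} {y} ∣p∣≡1 x∈p y∈p with x ≟ y
... | yes x≡y = x≡y
... | no  x≢y = contradiction (subst (∣ p - x - y ∣ <_) ∣p-x∣≡0 (x∈p⇒∣p-x∣<∣p∣ y∈p-x)) n≮0
  where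
  y∈p-x : y ∈ p - x
  y∈p-x = x∈p∧x≢y⇒x∈p-y y∈p (x≢y ∘ sym)
  ∣p-x∣≡0 : ∣ p - x ∣ ≡ 0
  ∣p-x∣≡0 = n<1⇒n≡0 (<-≤-trans (x∈p⇒∣p-x∣<∣p∣ x∈p) (≤-reflexive ∣p∣≡1))

tokenJump⇒⊆∪⁅⁆ : ∀ {A B : Subset n} {v} → TokenJump A B → v ∈ B → v ∉ A → B ⊆ A ∪ ⁅ v ⁆
tokenJump⇒⊆∪⁅⁆ {A = A} {B} {v} (∣A∣≡∣B∣ , ∣A─B∣≡1) v∈B v∉A {w} w∈B with w ∈? A
... | yes w∈A = x∈p∪q⁺ (inj₁ w∈A)
... | no  w∉A = x∈p∪q⁺ (inj₂ (subst (_∈ ⁅ v ⁆) v≡w (x∈⁅x⁆ v)))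
  where
  ∣B─A∣≡1 : ∣ B ─ A ∣ ≡ 1
  ∣B─A∣≡1 = trans (∣p∣≡∣q∣⇒∣q─p∣≡∣p─q∣ A B ∣A∣≡∣B∣) ∣A─B∣≡1
  v≡w : v ≡ w
  v≡w = ∣p∣≡1∧x∈p∧y∈p⇒x≡y ∣B─A∣≡1 (x∈p∧x∉q⇒x∈p─q v∈B v∉A) (x∈p∧x∉q⇒x∈p─q w∈B w∉A)

tokenJump⇒∪⁅⁆≡∪ : ∀ {A B : Subset n} {v} → TokenJump A B → v ∈ B → v ∉ A → A ∪ ⁅ v ⁆ ≡ A ∪ B
tokenJump⇒∪⁅⁆≡∪ {A = A} {B} {v} jump v∈B v∉A = ⊆-antisym A∪⁅v⁆⊆A∪B A∪B⊆A∪⁅v⁆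
  where
  A∪⁅v⁆⊆A∪B : A ∪ ⁅ v ⁆ ⊆ A ∪ B
  A∪⁅v⁆⊆A∪B w∈ with x∈p∪q⁻ A ⁅ v ⁆ w∈
  ... | inj₁ w∈A = x∈p∪q⁺ (inj₁ w∈A)
  ... | inj₂ w∈⁅v⁆ = x∈p∪q⁺ (inj₂ (subst (_∈ B) (sym (x∈⁅y⁆⇒x≡y v w∈⁅v⁆)) v∈B))
  A∪B⊆A∪⁅v⁆ : A ∪ B ⊆ A ∪ ⁅ v ⁆
  A∪B⊆A∪⁅v⁆ w∈ with x∈p∪q⁻ A B w∈
  ... | inj₁ w∈A = x∈p∪q⁺ (inj₁ w∈A)
  ... | inj₂ w∈B = tokenJump⇒⊆∪⁅⁆ jump v∈B v∉A w∈B

ClosedUnderUnion : (Subset n → Set) → Set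
ClosedUnderUnion X = ∀ A B → X A → X B → X (A ∪ B)

×-closedUnderUnion : {X Y : Subset n → Set} →
  ClosedUnderUnion X → ClosedUnderUnion Y → ClosedUnderUnion (λ A → X A × Y A)
×-closedUnderUnion ∪X ∪Y A B (xA , yA) (xB , yB) = ∪X A B xA xB , ∪Y A B yA yB

closedUnderUnion⇒reconfigurationMonotoneIncreasing : {X : Subset n → Set} →
  ClosedUnderUnion X → ReconfigurationMonotoneIncreasing X
closedUnderUnion⇒reconfigurationMonotoneIncreasing {X = X} ∪X A B xA xB jump v v∈B v∉A =
  subst X (sym (tokenJump⇒∪⁅⁆≡∪ jump v∈B v∉A)) (∪X A B xA xB)

module _ (G : Graph n) where

  deg-mono : ∀ {A C} → A ⊆ C → ∀ w → deg G A w ≤ deg G C w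
  deg-mono {A} A⊆C w = p⊆q⇒∣p∣≤∣q∣ λ u∈N∩A →
    let u∈N , u∈A = x∈p∩q⁻ (N G w) A u∈N∩A in x∈p∩q⁺ (u∈N , A⊆C u∈A)

  defends-mono : ∀ {A C} → A ⊆ C → ∀ w → deg G A w + 1 ≥ deg G (∁ A) w → deg G C w + 1 ≥ deg G (∁ C) w
  defends-mono A⊆C w defended =
    ≤-trans (deg-mono (p⊆q⇒∁p⊇∁q A⊆C) w) (≤-trans defended (+-monoˡ-≤ 1 (deg-mono A⊆C w)))

  attacks-mono : ∀ {A C} → A ⊆ C → ∀ w → deg G A w ≥ deg G (∁ A) w + 1 → deg G C w ≥ deg G (∁ C) w + 1
  attacks-mono A⊆C w attacked =
    ≤-trans (+-monoˡ-≤ 1 (deg-mono (p⊆q⇒∁p⊇∁q A⊆C) w)) (≤-trans attacked (deg-mono A⊆C w))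

  ∈∂∪⇒∈∂⊎∈∂ : ∀ {A B w} → _∈∂_ G w (A ∪ B) → _∈∂_ G w A ⊎ _∈∂_ G w B
  ∈∂∪⇒∈∂⊎∈∂ (inj₁ w∈A∪B , w∉A∪B) = contradiction w∈A∪B w∉A∪B
  ∈∂∪⇒∈∂⊎∈∂ {A} {B} (inj₂ (u , u∈A∪B , w∈Nu) , w∉A∪B) with x∈p∪q⁻ A B u∈A∪B
  ... | inj₁ u∈A = inj₁ (inj₂ (u , u∈A , w∈Nu) , w∉A∪B ∘ x∈p∪q⁺ ∘ inj₁)
  ... | inj₂ u∈B = inj₂ (inj₂ (u , u∈B , w∈Nu) , w∉A∪B ∘ x∈p∪q⁺ ∘ inj₂)

  defensiveAlliance-∪ : ClosedUnderUnion (DefensiveAlliance G)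
  defensiveAlliance-∪ A B defA defB w w∈A∪B with x∈p∪q⁻ A B w∈A∪B
  ... | inj₁ w∈A = defends-mono (p⊆p∪q B) w (defA w w∈A)
  ... | inj₂ w∈B = defends-mono (q⊆p∪q A B) w (defB w w∈B)

  offensiveAlliance-∪ : ClosedUnderUnion (OffensiveAlliance G)
  offensiveAlliance-∪ A B offA offB w w∈∂A∪B with ∈∂∪⇒∈∂⊎∈∂ w∈∂A∪B
  ... | inj₁ w∈∂A = attacks-mono (p⊆p∪q B) w (offA w w∈∂A)
  ... | inj₂ w∈∂B = attacks-mono (q⊆p∪q A B) w (offB w w∈∂B)

  dominating-∪ : ClosedUnderUnion (Dominating G)
  dominating-∪ A B domA _ w with domA w
  ... | inj₁ w∈A = inj₁ (p⊆p∪q B w∈A)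
  ... | inj₂ (u , u∈A , w∈Nu) = inj₂ (u , p⊆p∪q B u∈A , w∈Nu)

proposition3 : ∀ {n : ℕ} (G : Graph n) →
    ReconfigurationMonotoneIncreasing (DefensiveAlliance G)
    × ReconfigurationMonotoneIncreasing (OffensiveAlliance G)
    × ReconfigurationMonotoneIncreasing (PowerfulAlliance G)
    × ReconfigurationMonotoneIncreasing (GlobalDefensiveAlliance G)
    × ReconfigurationMonotoneIncreasing (GlobalOffensiveAlliance G)
    × ReconfigurationMonotoneIncreasing (GlobalPowerfulAlliance G)
proposition3 G =
    monotone defensive
  , monotone offensive
  , monotone powerful
  , monotone (×-closedUnderUnion defensive dominating)
  , monotone (×-closedUnderUnion offensive dominating)
  , monotone (×-closedUnderUnion powerful dominating)
  where
  monotone : ∀ {X} → ClosedUnderUnion X → ReconfigurationMonotoneIncreasing X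
  monotone = closedUnderUnion⇒reconfigurationMonotoneIncreasing
  defensive : ClosedUnderUnion (DefensiveAlliance G)
  defensive = defensiveAlliance-∪ G
  offensive : ClosedUnderUnion (OffensiveAlliance G)
  offensive = offensiveAlliance-∪ G
  dominating : ClosedUnderUnion (Dominating G)
  dominating = dominating-∪ G
  powerful : ClosedUnderUnion (PowerfulAlliance G)
  powerful = ×-closedUnderUnion defensive offensive
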